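{- Let $q$ be a complex number with $|q|<1$ and let $k\geqslant 1$ be an integer. Then $$\frac{1}{(q;q)_\infty} \sum_{n=1}^k (-1)^{n-1} q^{n(n+1)/2} = \sum_{n=0}^\infty \frac{q^{(n+1)^2}}{(q;q)_n(q;q)_{n+1}} + (-1)^{k-1} q^{(k+1)(k+2)/2} \sum_{n=0}^\infty \frac{q^{n(n+k+2)}}{(q;q)_n(q;q)_{n+k+1}}.$$
   Context: Notation: $(a;q)_0=1$, $(a;q)_n=(1-a)(1-aq)\cdots(1-aq^{n-1})$ for $n>0$, $(a;q)_\infty=\lim_{n\to\infty}(a;q)_n$. -}

module Defs where

open import Data.Nat using (ℕ; zero; suc; _∸_; _≟_)
  renaming (_+_ to _+ℕ_; _*_ to _*ℕ_)
open import Data.Nat.DivMod using (_/_)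
open import Data.Nat.Divisibility using (_∣?_)
open import Data.Integer using (ℤ; 0ℤ; 1ℤ; -_; _+_; _*_)
open import Data.List using (List; map; foldr; upTo)
open import Relation.Nullary.Decidable using (Dec; yes; no)
open import Relation.Binary.PropositionalEquality using (_≡_)

FPS : Set
FPS = ℕ → ℤ

_≈ₚ_ : FPS → FPS → Set
f ≈ₚ g = ∀ m → f m ≡ g m

infix 4 _≈ₚ_

sumℤ : List ℤ → ℤ
sumℤ = foldr _+_ 0ℤ

_+ₚ_ : FPS → FPS → FPS
(f +ₚ g) m = f m + g m

_*ₚ_ : FPS → FPS → FPS
(f *ₚ g) m = sumℤ (map (λ i → f i * g (m ∸ i)) (upTo (suc m)))

infixl 7 _*ₚ_
infixl 6 _+ₚ_

_·ₚ_ : ℤ → FPS → FPS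
(c ·ₚ f) m = c * f m

infixr 8 _·ₚ_

qpow : ℕ → FPS
qpow a m with m ≟ a
... | yes _ = 1ℤ
... | no  _ = 0ℤ

oneₚ : FPS
oneₚ = qpow 0

-- 1/(1 - q^j) = Σ_{r ≥ 0} q^{j r}, for j ≥ 1 (here j = suc j')
geomInv : ℕ → FPS
geomInv j' m with suc j' ∣? m
... | yes _ = 1ℤ
... | no  _ = 0ℤ

qPochInv : ℕ → FPS
qPochInv zero    = oneₚ
qPochInv (suc n) = qPochInv n *ₚ geomInv n

-- 1/(q;q)_∞ : coefficient of q^m equals that of 1/(q;q)_m
-- (the factors 1/(1-q^j) with j > m do not affect the coefficient of q^m)
qPochInvInf : FPS
qPochInvInf m = qPochInv m m

-- formal infinite sum Σ_{n ≥ 0} a n, for families where a n has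
-- q-adic order ≥ n (so coefficient m only receives terms with n ≤ m)
Σ∞ : (ℕ → FPS) → FPS
Σ∞ a m = sumℤ (map (λ n → a n m) (upTo (suc m)))

Σ< : ℕ → (ℕ → FPS) → FPS
Σ< k a m = sumℤ (map (λ n → a n m) (upTo k))

sgn : ℕ → ℤ
sgn zero    = 1ℤ
sgn (suc n) = - sgn n

tri : ℕ → ℕ
tri n = (n *ℕ suc n) / 2

module Submission where

-- Write D(a, b) = Σₙ q^{n(n+a)} / ((q;q)ₙ (q;q)_{n+b}).  Splitting
-- 1/(q;q)_{m+1} = 1/(q;q)ₘ + q^{m+1}/(q;q)_{m+1} in the second, resp. the first,
-- factor gives
--   D(a, b+1) = D(a, b) + q^{b+1} D(a+1, b+1)   and
--   D(a, b)   = D(a+1, b) + q^{a+1} D(a+2, b+1).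
-- Expanding D(m, m+1) both ways, Aₘ = D(m, m) satisfies
-- Aₘ + q^{m+1} A_{m+1} = A_{m+1} + q^{m+1} A_{m+2}, so by strong induction on the
-- coefficient index all Aₘ coincide.  Modulo q^{c+1} only the n = 0 term of A_c
-- survives, namely 1/(q;q)_c ≡ 1/(q;q)_∞; hence every Aₘ equals 1/(q;q)_∞.  The
-- first recurrence at (j+2, j+1) now reads 1/(q;q)_∞ = Gⱼ + q^{j+2} G_{j+1} with
-- Gⱼ = D(j+2, j+1), and multiplied by (-1)ʲ q^{T(j+1)} these identities telescope,
-- since T(j+1) + j + 2 = T(j+2).

open import Defs
open import Data.Nat using (ℕ; zero; suc; _≤_; _<_; _∸_; _+_; _*_; z≤n; s≤s; z<s; s<s; _≟_)
open import Data.Nat.Properties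
  using (suc-injective; ≤-refl; ≤-trans; <⇒≱; <-≤-trans; +-suc; +-comm; m≤n+m; m≤m*n; m≤n*m; +-∸-assoc; n∸n≡0)
open import Data.Nat.Divisibility using (_∣?_; divides; ∣⇒≤; ∣m+n∣m⇒∣n; ∣m∣n⇒∣m+n; ∣-refl)
open import Data.Nat.DivMod using (_/_; /-congˡ; +-distrib-/-∣ʳ; m*n/n≡m)
open import Data.Nat.Induction using (<-rec)
open import Data.Integer using (ℤ; 0ℤ; 1ℤ; -_) renaming (_+_ to _+ℤ_; _*_ to _*ℤ_)
import Data.Integer.Properties as ℤ
open import Algebra.Properties.AbelianGroup ℤ.+-0-abelianGroup using (∙-cancelʳ)
open import Data.List using (map; applyUpTo; upTo)
open import Data.List.Properties using (map-cong)
open import Function using (_∘_; id)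
open import Relation.Nullary using (yes; no; contradiction)
open import Relation.Binary using (Setoid)
open import Relation.Binary.PropositionalEquality
import Relation.Binary.Reasoning.Setoid as SetoidReasoning
import Data.Integer.Tactic.RingSolver as ℤ-Solver
import Data.Nat.Tactic.RingSolver as ℕ-Solver

∑ : ℕ → (ℕ → ℤ) → ℤ
∑ zero    f = 0ℤ
∑ (suc n) f = f 0 +ℤ ∑ n (f ∘ suc)

sumℤ-map-applyUpTo : ∀ n (g : ℕ → ℕ) (f : ℕ → ℤ) → sumℤ (map f (applyUpTo g n)) ≡ ∑ n (f ∘ g)
sumℤ-map-applyUpTo zero    g f = refl
sumℤ-map-applyUpTo (suc n) g f = cong (f (g 0) +ℤ_) (sumℤ-map-applyUpTo n (g ∘ suc) f)

∑-cong : ∀ n {f g : ℕ → ℤ} → (∀ i → i < n → f i ≡ g i) → ∑ n f ≡ ∑ n g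
∑-cong zero    f≡g = refl
∑-cong (suc n) f≡g = cong₂ _+ℤ_ (f≡g 0 z<s) (∑-cong n (λ i i<n → f≡g (suc i) (s<s i<n)))

∑-zero : ∀ n {f : ℕ → ℤ} → (∀ i → i < n → f i ≡ 0ℤ) → ∑ n f ≡ 0ℤ
∑-zero zero    f≡0 = refl
∑-zero (suc n) f≡0 = cong₂ _+ℤ_ (f≡0 0 z<s) (∑-zero n (λ i i<n → f≡0 (suc i) (s<s i<n)))

∑-+ : ∀ n (f g : ℕ → ℤ) → ∑ n (λ i → f i +ℤ g i) ≡ ∑ n f +ℤ ∑ n g
∑-+ zero    f g = refl
∑-+ (suc n) f g =
  trans (cong (f 0 +ℤ g 0 +ℤ_) (∑-+ n (f ∘ suc) (g ∘ suc))) (interchange (f 0) (g 0) _ _)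
  where
  interchange : ∀ a b c d → a +ℤ b +ℤ (c +ℤ d) ≡ a +ℤ c +ℤ (b +ℤ d)
  interchange = ℤ-Solver.solve-∀

∑-*ˡ : ∀ n z (f : ℕ → ℤ) → ∑ n (λ i → z *ℤ f i) ≡ z *ℤ ∑ n f
∑-*ˡ zero    z f = sym (ℤ.*-zeroʳ z)
∑-*ˡ (suc n) z f =
  trans (cong (z *ℤ f 0 +ℤ_) (∑-*ˡ n z (f ∘ suc))) (sym (ℤ.*-distribˡ-+ z (f 0) _))

∑-suc : ∀ n (f : ℕ → ℤ) → ∑ (suc n) f ≡ ∑ n f +ℤ f n
∑-suc zero    f = trans (ℤ.+-identityʳ (f 0)) (sym (ℤ.+-identityˡ (f 0)))
∑-suc (suc n) f = trans (cong (f 0 +ℤ_) (∑-suc n (f ∘ suc))) (sym (ℤ.+-assoc (f 0) _ _))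

∑-extend : ∀ n d (f : ℕ → ℤ) → (∀ i → n ≤ i → f i ≡ 0ℤ) → ∑ (d + n) f ≡ ∑ n f
∑-extend n zero    f f≡0 = refl
∑-extend n (suc d) f f≡0 = begin
  ∑ (suc d + n) f           ≡⟨ ∑-suc (d + n) f ⟩
  ∑ (d + n) f +ℤ f (d + n)  ≡⟨ cong₂ _+ℤ_ (∑-extend n d f f≡0) (f≡0 (d + n) (m≤n+m n d)) ⟩
  ∑ n f +ℤ 0ℤ               ≡⟨ ℤ.+-identityʳ _ ⟩
  ∑ n f                     ∎
  where open ≡-Reasoning

∑-alternating-telescope : ∀ (x : ℕ → ℤ) k →
  ∑ (suc k) (λ i → sgn i *ℤ (x i +ℤ x (suc i))) ≡ x 0 +ℤ sgn k *ℤ x (suc k)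
∑-alternating-telescope x zero    = base (x 0) (x 1)
  where
  base : ∀ a b → 1ℤ *ℤ (a +ℤ b) +ℤ 0ℤ ≡ a +ℤ 1ℤ *ℤ b
  base = ℤ-Solver.solve-∀
∑-alternating-telescope x (suc k) = begin
  ∑ (suc (suc k)) t                   ≡⟨ ∑-suc (suc k) t ⟩
  ∑ (suc k) t +ℤ t (suc k)            ≡⟨ cong (_+ℤ t (suc k)) (∑-alternating-telescope x k) ⟩
  x 0 +ℤ sgn k *ℤ x (suc k) +ℤ t (suc k)  ≡⟨ cancel (x 0) (sgn k) (x (suc k)) (x (suc (suc k))) ⟩
  x 0 +ℤ sgn (suc k) *ℤ x (suc (suc k)) ∎
  where
  open ≡-Reasoning
  t : ℕ → ℤ
  t i = sgn i *ℤ (x i +ℤ x (suc i))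
  cancel : ∀ a s b c → a +ℤ s *ℤ b +ℤ (- s) *ℤ (b +ℤ c) ≡ a +ℤ (- s) *ℤ c
  cancel = ℤ-Solver.solve-∀

module ≈ₚ-Reasoning = SetoidReasoning (ℕ →-setoid ℤ)
open Setoid (ℕ →-setoid ℤ) using ()
  renaming (refl to ≈ₚ-refl; sym to ≈ₚ-sym; trans to ≈ₚ-trans)

+ₚ-cong : ∀ {f f′ g g′} → f ≈ₚ f′ → g ≈ₚ g′ → f +ₚ g ≈ₚ f′ +ₚ g′
+ₚ-cong f≈ g≈ c = cong₂ _+ℤ_ (f≈ c) (g≈ c)

+ₚ-congˡ : ∀ f {g g′} → g ≈ₚ g′ → f +ₚ g ≈ₚ f +ₚ g′
+ₚ-congˡ f g≈ c = cong (f c +ℤ_) (g≈ c)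

+ₚ-comm : ∀ f g → f +ₚ g ≈ₚ g +ₚ f
+ₚ-comm f g c = ℤ.+-comm (f c) (g c)

+ₚ-assoc : ∀ f g h → f +ₚ g +ₚ h ≈ₚ f +ₚ (g +ₚ h)
+ₚ-assoc f g h c = ℤ.+-assoc (f c) (g c) (h c)

·ₚ-cong : ∀ z {f g} → f ≈ₚ g → z ·ₚ f ≈ₚ z ·ₚ g
·ₚ-cong z f≈g c = cong (z *ℤ_) (f≈g c)

*ₚ-coeff : ∀ f g c → (f *ₚ g) c ≡ ∑ (suc c) (λ i → f i *ℤ g (c ∸ i))
*ₚ-coeff f g c = sumℤ-map-applyUpTo (suc c) id (λ i → f i *ℤ g (c ∸ i))

*ₚ-congˡ : ∀ f {g g′} → g ≈ₚ g′ → f *ₚ g ≈ₚ f *ₚ g′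
*ₚ-congˡ f g≈ c = cong sumℤ (map-cong (λ i → cong (f i *ℤ_) (g≈ (c ∸ i))) (upTo (suc c)))

*ₚ-congʳ : ∀ g {f f′} → f ≈ₚ f′ → f *ₚ g ≈ₚ f′ *ₚ g
*ₚ-congʳ g f≈ c = cong sumℤ (map-cong (λ i → cong (_*ℤ g (c ∸ i)) (f≈ i)) (upTo (suc c)))

*ₚ-distribˡ-+ₚ : ∀ f g h → f *ₚ (g +ₚ h) ≈ₚ f *ₚ g +ₚ f *ₚ h
*ₚ-distribˡ-+ₚ f g h c = begin
  (f *ₚ (g +ₚ h)) c
    ≡⟨ *ₚ-coeff f (g +ₚ h) c ⟩
  ∑ (suc c) (λ i → f i *ℤ (g (c ∸ i) +ℤ h (c ∸ i)))
    ≡⟨ ∑-cong (suc c) (λ i _ → ℤ.*-distribˡ-+ (f i) (g (c ∸ i)) (h (c ∸ i))) ⟩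
  ∑ (suc c) (λ i → f i *ℤ g (c ∸ i) +ℤ f i *ℤ h (c ∸ i))
    ≡⟨ ∑-+ (suc c) (λ i → f i *ℤ g (c ∸ i)) (λ i → f i *ℤ h (c ∸ i)) ⟩
  ∑ (suc c) (λ i → f i *ℤ g (c ∸ i)) +ℤ ∑ (suc c) (λ i → f i *ℤ h (c ∸ i))
    ≡⟨ sym (cong₂ _+ℤ_ (*ₚ-coeff f g c) (*ₚ-coeff f h c)) ⟩
  (f *ₚ g +ₚ f *ₚ h) c ∎
  where open ≡-Reasoning

*ₚ-distribʳ-+ₚ : ∀ f g h → (g +ₚ h) *ₚ f ≈ₚ g *ₚ f +ₚ h *ₚ f
*ₚ-distribʳ-+ₚ f g h c = begin
  ((g +ₚ h) *ₚ f) c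
    ≡⟨ *ₚ-coeff (g +ₚ h) f c ⟩
  ∑ (suc c) (λ i → (g i +ℤ h i) *ℤ f (c ∸ i))
    ≡⟨ ∑-cong (suc c) (λ i _ → ℤ.*-distribʳ-+ (f (c ∸ i)) (g i) (h i)) ⟩
  ∑ (suc c) (λ i → g i *ℤ f (c ∸ i) +ℤ h i *ℤ f (c ∸ i))
    ≡⟨ ∑-+ (suc c) (λ i → g i *ℤ f (c ∸ i)) (λ i → h i *ℤ f (c ∸ i)) ⟩
  ∑ (suc c) (λ i → g i *ℤ f (c ∸ i)) +ℤ ∑ (suc c) (λ i → h i *ℤ f (c ∸ i))
    ≡⟨ sym (cong₂ _+ℤ_ (*ₚ-coeff g f c) (*ₚ-coeff h f c)) ⟩
  (g *ₚ f +ₚ h *ₚ f) c ∎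
  where open ≡-Reasoning

*ₚ-scalarˡ : ∀ z f g → (z ·ₚ f) *ₚ g ≈ₚ z ·ₚ (f *ₚ g)
*ₚ-scalarˡ z f g c = begin
  ((z ·ₚ f) *ₚ g) c                           ≡⟨ *ₚ-coeff (z ·ₚ f) g c ⟩
  ∑ (suc c) (λ i → z *ℤ f i *ℤ g (c ∸ i))     ≡⟨ ∑-cong (suc c) (λ i _ → ℤ.*-assoc z (f i) (g (c ∸ i))) ⟩
  ∑ (suc c) (λ i → z *ℤ (f i *ℤ g (c ∸ i)))   ≡⟨ ∑-*ˡ (suc c) z (λ i → f i *ℤ g (c ∸ i)) ⟩
  z *ℤ ∑ (suc c) (λ i → f i *ℤ g (c ∸ i))     ≡⟨ cong (z *ℤ_) (sym (*ₚ-coeff f g c)) ⟩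
  (z ·ₚ (f *ₚ g)) c                           ∎
  where open ≡-Reasoning

*ₚ-scalarʳ : ∀ z f g → f *ₚ (z ·ₚ g) ≈ₚ z ·ₚ (f *ₚ g)
*ₚ-scalarʳ z f g c = begin
  (f *ₚ (z ·ₚ g)) c                           ≡⟨ *ₚ-coeff f (z ·ₚ g) c ⟩
  ∑ (suc c) (λ i → f i *ℤ (z *ℤ g (c ∸ i)))   ≡⟨ ∑-cong (suc c) (λ i _ → swap (f i) z (g (c ∸ i))) ⟩
  ∑ (suc c) (λ i → z *ℤ (f i *ℤ g (c ∸ i)))   ≡⟨ ∑-*ˡ (suc c) z (λ i → f i *ℤ g (c ∸ i)) ⟩
  z *ℤ ∑ (suc c) (λ i → f i *ℤ g (c ∸ i))     ≡⟨ cong (z *ℤ_) (sym (*ₚ-coeff f g c)) ⟩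
  (z ·ₚ (f *ₚ g)) c                           ∎
  where
  open ≡-Reasoning
  swap : ∀ a b d → a *ℤ (b *ℤ d) ≡ b *ℤ (a *ℤ d)
  swap = ℤ-Solver.solve-∀

*ₚ-identityˡ : ∀ f → oneₚ *ₚ f ≈ₚ f
*ₚ-identityˡ f c = begin
  (oneₚ *ₚ f) c
    ≡⟨ *ₚ-coeff oneₚ f c ⟩
  1ℤ *ℤ f c +ℤ ∑ c (λ i → 0ℤ *ℤ f (c ∸ suc i))
    ≡⟨ cong₂ _+ℤ_ (ℤ.*-identityˡ (f c)) (∑-zero c (λ _ _ → refl)) ⟩
  f c +ℤ 0ℤ
    ≡⟨ ℤ.+-identityʳ (f c) ⟩
  f c ∎
  where open ≡-Reasoning

*ₚ-identityʳ : ∀ f → f *ₚ oneₚ ≈ₚ f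
*ₚ-identityʳ f c = begin
  (f *ₚ oneₚ) c                                          ≡⟨ *ₚ-coeff f oneₚ c ⟩
  ∑ (suc c) (λ i → f i *ℤ oneₚ (c ∸ i))                  ≡⟨ ∑-suc c (λ i → f i *ℤ oneₚ (c ∸ i)) ⟩
  ∑ c (λ i → f i *ℤ oneₚ (c ∸ i)) +ℤ f c *ℤ oneₚ (c ∸ c)  ≡⟨ cong₂ _+ℤ_ (∑-zero c off-diagonal) diagonal ⟩
  0ℤ +ℤ f c                                              ≡⟨ ℤ.+-identityˡ (f c) ⟩
  f c                                                    ∎
  where
  open ≡-Reasoning
  off-diagonal : ∀ i → i < c → f i *ℤ oneₚ (c ∸ i) ≡ 0ℤ
  off-diagonal i i<c = trans (cong (λ e → f i *ℤ oneₚ e) (+-∸-assoc 1 i<c)) (ℤ.*-zeroʳ (f i))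
  diagonal : f c *ℤ oneₚ (c ∸ c) ≡ f c
  diagonal = trans (cong (λ e → f c *ℤ oneₚ e) (n∸n≡0 c)) (ℤ.*-identityʳ (f c))

data ShiftView (a : ℕ) : ℕ → Set where
  below  : ∀ {c} → c < a → ShiftView a c
  beyond : ∀ d → ShiftView a (a + d)

shiftView : ∀ a c → ShiftView a c
shiftView zero    c       = beyond c
shiftView (suc a) zero    = below z<s
shiftView (suc a) (suc c) with shiftView a c
... | below c<a = below (s<s c<a)
... | beyond d  = beyond d

shift₁ : FPS → FPS
shift₁ f zero    = 0ℤ
shift₁ f (suc c) = f c

shift : ℕ → FPS → FPS
shift zero    f = f
shift (suc a) f = shift₁ (shift a f)

shift₁-cong : ∀ {f g} → f ≈ₚ g → shift₁ f ≈ₚ shift₁ g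
shift₁-cong f≈g zero    = refl
shift₁-cong f≈g (suc c) = f≈g c

shift-cong : ∀ a {f g} → f ≈ₚ g → shift a f ≈ₚ shift a g
shift-cong zero    f≈g = f≈g
shift-cong (suc a) f≈g = shift₁-cong (shift-cong a f≈g)

shift-+ₚ : ∀ a f g → shift a (f +ₚ g) ≈ₚ shift a f +ₚ shift a g
shift-+ₚ zero    f g c       = refl
shift-+ₚ (suc a) f g zero    = refl
shift-+ₚ (suc a) f g (suc c) = shift-+ₚ a f g c

shift-shift : ∀ a b f → shift a (shift b f) ≈ₚ shift (a + b) f
shift-shift zero    b f = ≈ₚ-refl
shift-shift (suc a) b f = shift₁-cong (shift-shift a b f)

shift-below : ∀ a f {c} → c < a → shift a f c ≡ 0ℤ
shift-below (suc a) f {zero}  _         = refl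
shift-below (suc a) f {suc c} (s<s c<a) = shift-below a f c<a

shift-at : ∀ a f d → shift a f (a + d) ≡ f d
shift-at zero    f d = refl
shift-at (suc a) f d = shift-at a f d

shift₁-*ₚˡ : ∀ f g → shift₁ f *ₚ g ≈ₚ shift₁ (f *ₚ g)
shift₁-*ₚˡ f g zero    = trans (*ₚ-coeff (shift₁ f) g 0) (ℤ.+-identityʳ _)
shift₁-*ₚˡ f g (suc c) = begin
  (shift₁ f *ₚ g) (suc c)                              ≡⟨ *ₚ-coeff (shift₁ f) g (suc c) ⟩
  0ℤ +ℤ ∑ (suc c) (λ i → f i *ℤ g (c ∸ i))            ≡⟨ ℤ.+-identityˡ _ ⟩
  ∑ (suc c) (λ i → f i *ℤ g (c ∸ i))                  ≡⟨ sym (*ₚ-coeff f g c) ⟩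
  (f *ₚ g) c                                           ∎
  where open ≡-Reasoning

shift₁-*ₚʳ : ∀ f g → f *ₚ shift₁ g ≈ₚ shift₁ (f *ₚ g)
shift₁-*ₚʳ f g zero    = trans (*ₚ-coeff f (shift₁ g) 0) (trans (ℤ.+-identityʳ _) (ℤ.*-zeroʳ (f 0)))
shift₁-*ₚʳ f g (suc c) = begin
  (f *ₚ shift₁ g) (suc c)
    ≡⟨ *ₚ-coeff f (shift₁ g) (suc c) ⟩
  ∑ (suc (suc c)) (λ i → f i *ℤ shift₁ g (suc c ∸ i))
    ≡⟨ ∑-suc (suc c) (λ i → f i *ℤ shift₁ g (suc c ∸ i)) ⟩
  ∑ (suc c) (λ i → f i *ℤ shift₁ g (suc c ∸ i)) +ℤ f (suc c) *ℤ shift₁ g (c ∸ c)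
    ≡⟨ cong₂ _+ℤ_ (∑-cong (suc c) inner) last ⟩
  ∑ (suc c) (λ i → f i *ℤ g (c ∸ i)) +ℤ 0ℤ
    ≡⟨ trans (ℤ.+-identityʳ _) (sym (*ₚ-coeff f g c)) ⟩
  (f *ₚ g) c ∎
  where
  open ≡-Reasoning
  inner : ∀ i → i < suc c → f i *ℤ shift₁ g (suc c ∸ i) ≡ f i *ℤ g (c ∸ i)
  inner i (s≤s i≤c) = cong (λ e → f i *ℤ shift₁ g e) (+-∸-assoc 1 i≤c)
  last : f (suc c) *ℤ shift₁ g (c ∸ c) ≡ 0ℤ
  last = trans (cong (λ e → f (suc c) *ℤ shift₁ g e) (n∸n≡0 c)) (ℤ.*-zeroʳ (f (suc c)))

shift-*ₚˡ : ∀ a f g → shift a f *ₚ g ≈ₚ shift a (f *ₚ g)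
shift-*ₚˡ zero    f g = ≈ₚ-refl
shift-*ₚˡ (suc a) f g = ≈ₚ-trans (shift₁-*ₚˡ (shift a f) g) (shift₁-cong (shift-*ₚˡ a f g))

shift-*ₚʳ : ∀ a f g → f *ₚ shift a g ≈ₚ shift a (f *ₚ g)
shift-*ₚʳ zero    f g = ≈ₚ-refl
shift-*ₚʳ (suc a) f g = ≈ₚ-trans (shift₁-*ₚʳ f (shift a g)) (shift₁-cong (shift-*ₚʳ a f g))

qpow-suc : ∀ a c → qpow (suc a) (suc c) ≡ qpow a c
qpow-suc a c with c ≟ a | suc c ≟ suc a
... | yes _   | yes _   = refl
... | no _    | no _    = refl
... | yes c≡a | no c≢a  = contradiction (cong suc c≡a) c≢a
... | no c≢a  | yes c≡a = contradiction (suc-injective c≡a) c≢a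

qpow≈shift-oneₚ : ∀ a → qpow a ≈ₚ shift a oneₚ
qpow≈shift-oneₚ zero    c       = refl
qpow≈shift-oneₚ (suc a) zero    = refl
qpow≈shift-oneₚ (suc a) (suc c) = trans (qpow-suc a c) (qpow≈shift-oneₚ a c)

qpow-*ₚ : ∀ a f → qpow a *ₚ f ≈ₚ shift a f
qpow-*ₚ a f = ≈ₚ-trans (*ₚ-congʳ f (qpow≈shift-oneₚ a))
                (≈ₚ-trans (shift-*ₚˡ a oneₚ f) (shift-cong a (*ₚ-identityˡ f)))

*ₚ-qpow : ∀ a f → f *ₚ qpow a ≈ₚ shift a f
*ₚ-qpow a f = ≈ₚ-trans (*ₚ-congˡ f (qpow≈shift-oneₚ a))
                (≈ₚ-trans (shift-*ₚʳ a f oneₚ) (shift-cong a (*ₚ-identityʳ f)))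

-- The condition aₙ = O(qⁿ) under which Σ∞ a is the genuine infinite sum.
Admissible : (ℕ → FPS) → Set
Admissible a = ∀ n {c} → c < n → a n c ≡ 0ℤ

Σ∞-coeff : ∀ a c → Σ∞ a c ≡ ∑ (suc c) (λ n → a n c)
Σ∞-coeff a c = sumℤ-map-applyUpTo (suc c) id (λ n → a n c)

Σ∞-cong : ∀ {a b} → (∀ n → a n ≈ₚ b n) → Σ∞ a ≈ₚ Σ∞ b
Σ∞-cong a≈b c = cong sumℤ (map-cong (λ n → a≈b n c) (upTo (suc c)))

Σ∞-+ₚ : ∀ a b → Σ∞ (λ n → a n +ₚ b n) ≈ₚ Σ∞ a +ₚ Σ∞ b
Σ∞-+ₚ a b c = trans (Σ∞-coeff (λ n → a n +ₚ b n) c)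
  (trans (∑-+ (suc c) (λ n → a n c) (λ n → b n c)) (sym (cong₂ _+ℤ_ (Σ∞-coeff a c) (Σ∞-coeff b c))))

Σ∞-head : ∀ a → Admissible a → Σ∞ a ≈ₚ a 0 +ₚ Σ∞ (a ∘ suc)
Σ∞-head a adm c = trans (Σ∞-coeff a c) (cong (a 0 c +ℤ_) (sym (begin
  Σ∞ (a ∘ suc) c                                     ≡⟨ Σ∞-coeff (a ∘ suc) c ⟩
  ∑ (suc c) (λ n → a (suc n) c)                      ≡⟨ ∑-suc c (λ n → a (suc n) c) ⟩
  ∑ c (λ n → a (suc n) c) +ℤ a (suc c) c             ≡⟨ cong (∑ c (λ n → a (suc n) c) +ℤ_) (adm (suc c) ≤-refl) ⟩
  ∑ c (λ n → a (suc n) c) +ℤ 0ℤ                      ≡⟨ ℤ.+-identityʳ _ ⟩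
  ∑ c (λ n → a (suc n) c)                            ∎)))
  where open ≡-Reasoning

Σ∞-shift : ∀ s a → Admissible a → shift s (Σ∞ a) ≈ₚ Σ∞ (λ n → shift s (a n))
Σ∞-shift s a adm c with shiftView s c
... | below c<s = trans (shift-below s (Σ∞ a) c<s)
  (sym (trans (Σ∞-coeff (λ n → shift s (a n)) c) (∑-zero (suc c) (λ n _ → shift-below s (a n) c<s))))
... | beyond d = begin
  shift s (Σ∞ a) (s + d)                          ≡⟨ shift-at s (Σ∞ a) d ⟩
  Σ∞ a d                                          ≡⟨ Σ∞-coeff a d ⟩
  ∑ (suc d) (λ n → a n d)                         ≡⟨ sym (∑-extend (suc d) s _ (λ n → adm n)) ⟩
  ∑ (s + suc d) (λ n → a n d)                     ≡⟨ cong (λ l → ∑ l (λ n → a n d)) (+-suc s d) ⟩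
  ∑ (suc (s + d)) (λ n → a n d)                   ≡⟨ ∑-cong (suc (s + d)) (λ n _ → sym (shift-at s (a n) d)) ⟩
  ∑ (suc (s + d)) (λ n → shift s (a n) (s + d))   ≡⟨ sym (Σ∞-coeff (λ n → shift s (a n)) (s + d)) ⟩
  Σ∞ (λ n → shift s (a n)) (s + d)                ∎
  where open ≡-Reasoning

Σ<-coeff : ∀ k a c → Σ< k a c ≡ ∑ k (λ i → a i c)
Σ<-coeff k a c = sumℤ-map-applyUpTo k id (λ i → a i c)

Σ<-cong : ∀ k {a b} → (∀ i → a i ≈ₚ b i) → Σ< k a ≈ₚ Σ< k b
Σ<-cong k a≈b c = cong sumℤ (map-cong (λ i → a≈b i c) (upTo k))

Σ<-suc : ∀ k a → Σ< (suc k) a ≈ₚ Σ< k a +ₚ a k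
Σ<-suc k a c = trans (Σ<-coeff (suc k) a c)
  (trans (∑-suc k (λ i → a i c)) (cong (_+ℤ a k c) (sym (Σ<-coeff k a c))))

*ₚ-distribˡ-Σ< : ∀ f k a → f *ₚ Σ< k a ≈ₚ Σ< k (λ i → f *ₚ a i)
*ₚ-distribˡ-Σ< f zero    a c = trans (*ₚ-coeff f (Σ< zero a) c) (∑-zero (suc c) (λ i _ → ℤ.*-zeroʳ (f i)))
*ₚ-distribˡ-Σ< f (suc k) a = begin
  f *ₚ Σ< (suc k) a                          ≈⟨ *ₚ-congˡ f (Σ<-suc k a) ⟩
  f *ₚ (Σ< k a +ₚ a k)                       ≈⟨ *ₚ-distribˡ-+ₚ f (Σ< k a) (a k) ⟩
  f *ₚ Σ< k a +ₚ f *ₚ a k                    ≈⟨ +ₚ-cong (*ₚ-distribˡ-Σ< f k a) (≈ₚ-refl {f *ₚ a k}) ⟩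
  Σ< k (λ i → f *ₚ a i) +ₚ f *ₚ a k          ≈⟨ Σ<-suc k (λ i → f *ₚ a i) ⟨
  Σ< (suc k) (λ i → f *ₚ a i)                ∎
  where open ≈ₚ-Reasoning

Σ<-alternating-telescope : ∀ (x : ℕ → FPS) k →
  Σ< (suc k) (λ i → sgn i ·ₚ (x i +ₚ x (suc i))) ≈ₚ x 0 +ₚ sgn k ·ₚ x (suc k)
Σ<-alternating-telescope x k c =
  trans (Σ<-coeff (suc k) (λ i → sgn i ·ₚ (x i +ₚ x (suc i))) c) (∑-alternating-telescope (λ i → x i c) k)

geomInv-rec : ∀ n → geomInv n ≈ₚ oneₚ +ₚ shift (suc n) (geomInv n)
geomInv-rec n c with shiftView (suc n) c
... | below {zero} _ = refl
... | below {suc c} c<n =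
  trans not-divisible (sym (trans (ℤ.+-identityˡ _) (shift-below (suc n) (geomInv n) c<n)))
  where
  not-divisible : geomInv n (suc c) ≡ 0ℤ
  not-divisible with suc n ∣? suc c
  ... | yes n∣c = contradiction (∣⇒≤ n∣c) (<⇒≱ c<n)
  ... | no  _   = refl
... | beyond d = trans periodic (sym (trans (ℤ.+-identityˡ _) (shift-at (suc n) (geomInv n) d)))
  where
  periodic : geomInv n (suc n + d) ≡ geomInv n d
  periodic with suc n ∣? suc n + d | suc n ∣? d
  ... | yes _       | yes _     = refl
  ... | no  _       | no  _     = refl
  ... | yes n∣n+d   | no  n∤d   = contradiction (∣m+n∣m⇒∣n n∣n+d ∣-refl) n∤d
  ... | no  n∤n+d   | yes n∣d   = contradiction (∣m∣n⇒∣m+n ∣-refl n∣d) n∤n+d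

qPochInv-rec : ∀ n → qPochInv (suc n) ≈ₚ qPochInv n +ₚ shift (suc n) (qPochInv (suc n))
qPochInv-rec n = begin
  qPochInv n *ₚ geomInv n
    ≈⟨ *ₚ-congˡ (qPochInv n) (geomInv-rec n) ⟩
  qPochInv n *ₚ (oneₚ +ₚ shift (suc n) (geomInv n))
    ≈⟨ *ₚ-distribˡ-+ₚ (qPochInv n) oneₚ (shift (suc n) (geomInv n)) ⟩
  qPochInv n *ₚ oneₚ +ₚ qPochInv n *ₚ shift (suc n) (geomInv n)
    ≈⟨ +ₚ-cong (*ₚ-identityʳ (qPochInv n)) (shift-*ₚʳ (suc n) (qPochInv n) (geomInv n)) ⟩
  qPochInv n +ₚ shift (suc n) (qPochInv (suc n)) ∎
  where open ≈ₚ-Reasoning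

qPochInv₂ : ℕ → ℕ → FPS
qPochInv₂ x y = qPochInv x *ₚ qPochInv y

qPochInv₂-recˡ : ∀ x y → qPochInv₂ (suc x) y ≈ₚ qPochInv₂ x y +ₚ shift (suc x) (qPochInv₂ (suc x) y)
qPochInv₂-recˡ x y = begin
  qPochInv (suc x) *ₚ qPochInv y
    ≈⟨ *ₚ-congʳ (qPochInv y) (qPochInv-rec x) ⟩
  (qPochInv x +ₚ shift (suc x) (qPochInv (suc x))) *ₚ qPochInv y
    ≈⟨ *ₚ-distribʳ-+ₚ (qPochInv y) (qPochInv x) (shift (suc x) (qPochInv (suc x))) ⟩
  qPochInv₂ x y +ₚ shift (suc x) (qPochInv (suc x)) *ₚ qPochInv y
    ≈⟨ +ₚ-congˡ (qPochInv₂ x y) (shift-*ₚˡ (suc x) (qPochInv (suc x)) (qPochInv y)) ⟩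
  qPochInv₂ x y +ₚ shift (suc x) (qPochInv₂ (suc x) y) ∎
  where open ≈ₚ-Reasoning

qPochInv₂-recʳ : ∀ x y → qPochInv₂ x (suc y) ≈ₚ qPochInv₂ x y +ₚ shift (suc y) (qPochInv₂ x (suc y))
qPochInv₂-recʳ x y = begin
  qPochInv x *ₚ qPochInv (suc y)
    ≈⟨ *ₚ-congˡ (qPochInv x) (qPochInv-rec y) ⟩
  qPochInv x *ₚ (qPochInv y +ₚ shift (suc y) (qPochInv (suc y)))
    ≈⟨ *ₚ-distribˡ-+ₚ (qPochInv x) (qPochInv y) (shift (suc y) (qPochInv (suc y))) ⟩
  qPochInv₂ x y +ₚ qPochInv x *ₚ shift (suc y) (qPochInv (suc y))
    ≈⟨ +ₚ-congˡ (qPochInv₂ x y) (shift-*ₚʳ (suc y) (qPochInv x) (qPochInv (suc y))) ⟩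
  qPochInv₂ x y +ₚ shift (suc y) (qPochInv₂ x (suc y)) ∎
  where open ≈ₚ-Reasoning

durfeeTerm : ℕ → ℕ → ℕ → FPS
durfeeTerm a b n = shift (n * (n + a)) (qPochInv₂ n (n + b))

durfee : ℕ → ℕ → FPS
durfee a b = Σ∞ (durfeeTerm a b)

n≤n*[n+a] : ∀ n a → n ≤ n * (n + a)
n≤n*[n+a] zero    a = z≤n
n≤n*[n+a] (suc n) a = m≤m*n (suc n) (suc n + a)

durfeeTerm-admissible : ∀ a b → Admissible (durfeeTerm a b)
durfeeTerm-admissible a b n c<n =
  shift-below (n * (n + a)) (qPochInv₂ n (n + b)) (<-≤-trans c<n (n≤n*[n+a] n a))

durfeeTerm-recʳ : ∀ a b n →
  durfeeTerm a (suc b) n ≈ₚ durfeeTerm a b n +ₚ shift (suc b) (durfeeTerm (suc a) (suc b) n)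
durfeeTerm-recʳ a b n = begin
  shift e (qPochInv₂ n (n + suc b))
    ≡⟨ cong (λ y → shift e (qPochInv₂ n y)) (+-suc n b) ⟩
  shift e (qPochInv₂ n (suc (n + b)))
    ≈⟨ shift-cong e (qPochInv₂-recʳ n (n + b)) ⟩
  shift e (qPochInv₂ n (n + b) +ₚ shift (suc (n + b)) (qPochInv₂ n (suc (n + b))))
    ≈⟨ shift-+ₚ e (qPochInv₂ n (n + b)) (shift (suc (n + b)) (qPochInv₂ n (suc (n + b)))) ⟩
  durfeeTerm a b n +ₚ shift e (shift (suc (n + b)) (qPochInv₂ n (suc (n + b))))
    ≈⟨ +ₚ-congˡ (durfeeTerm a b n) (shift-shift e (suc (n + b)) (qPochInv₂ n (suc (n + b)))) ⟩
  durfeeTerm a b n +ₚ shift (e + suc (n + b)) (qPochInv₂ n (suc (n + b)))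
    ≡⟨ cong₂ (λ e′ y → durfeeTerm a b n +ₚ shift e′ (qPochInv₂ n y)) (exponent n a b) (sym (+-suc n b)) ⟩
  durfeeTerm a b n +ₚ shift (suc b + n * (n + suc a)) (qPochInv₂ n (n + suc b))
    ≈⟨ +ₚ-congˡ (durfeeTerm a b n) (shift-shift (suc b) (n * (n + suc a)) (qPochInv₂ n (n + suc b))) ⟨
  durfeeTerm a b n +ₚ shift (suc b) (durfeeTerm (suc a) (suc b) n) ∎
  where
  open ≈ₚ-Reasoning
  e = n * (n + a)
  exponent : ∀ n a b → n * (n + a) + suc (n + b) ≡ suc b + n * (n + suc a)
  exponent = ℕ-Solver.solve-∀

durfeeTerm-recˡ : ∀ a b n → durfeeTerm a b (suc n) ≈ₚ
  durfeeTerm (suc a) b (suc n) +ₚ shift (suc a) (durfeeTerm (suc (suc a)) (suc b) n)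
durfeeTerm-recˡ a b n = begin
  shift e (qPochInv₂ (suc n) y)
    ≈⟨ shift-cong e (qPochInv₂-recˡ n y) ⟩
  shift e (qPochInv₂ n y +ₚ shift (suc n) (qPochInv₂ (suc n) y))
    ≈⟨ shift-+ₚ e (qPochInv₂ n y) (shift (suc n) (qPochInv₂ (suc n) y)) ⟩
  shift e (qPochInv₂ n y) +ₚ shift e (shift (suc n) (qPochInv₂ (suc n) y))
    ≈⟨ +ₚ-comm (shift e (qPochInv₂ n y)) (shift e (shift (suc n) (qPochInv₂ (suc n) y))) ⟩
  shift e (shift (suc n) (qPochInv₂ (suc n) y)) +ₚ shift e (qPochInv₂ n y)
    ≈⟨ +ₚ-cong (shift-shift e (suc n) (qPochInv₂ (suc n) y)) (≈ₚ-refl {shift e (qPochInv₂ n y)}) ⟩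
  shift (e + suc n) (qPochInv₂ (suc n) y) +ₚ shift e (qPochInv₂ n y)
    ≡⟨ cong₂ _+ₚ_ (cong (λ e′ → shift e′ (qPochInv₂ (suc n) y)) (exponentʳ n a))
                  (cong₂ (λ e′ y′ → shift e′ (qPochInv₂ n y′)) (exponentˡ n a) (sym (+-suc n b))) ⟩
  durfeeTerm (suc a) b (suc n) +ₚ shift (suc a + n * (n + suc (suc a))) (qPochInv₂ n (n + suc b))
    ≈⟨ +ₚ-congˡ (durfeeTerm (suc a) b (suc n))
                (shift-shift (suc a) (n * (n + suc (suc a))) (qPochInv₂ n (n + suc b))) ⟨
  durfeeTerm (suc a) b (suc n) +ₚ shift (suc a) (durfeeTerm (suc (suc a)) (suc b) n) ∎
  where
  open ≈ₚ-Reasoning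
  e = suc n * (suc n + a)
  y = suc n + b
  exponentˡ : ∀ n a → suc n * (suc n + a) ≡ suc a + n * (n + suc (suc a))
  exponentˡ = ℕ-Solver.solve-∀
  exponentʳ : ∀ n a → suc n * (suc n + a) + suc n ≡ suc n * (suc n + suc a)
  exponentʳ = ℕ-Solver.solve-∀

durfee-recʳ : ∀ a b → durfee a (suc b) ≈ₚ durfee a b +ₚ shift (suc b) (durfee (suc a) (suc b))
durfee-recʳ a b = begin
  durfee a (suc b)
    ≈⟨ Σ∞-cong (durfeeTerm-recʳ a b) ⟩
  Σ∞ (λ n → durfeeTerm a b n +ₚ u n)
    ≈⟨ Σ∞-+ₚ (durfeeTerm a b) u ⟩
  durfee a b +ₚ Σ∞ u
    ≈⟨ +ₚ-congˡ (durfee a b)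
                (Σ∞-shift (suc b) (durfeeTerm (suc a) (suc b)) (durfeeTerm-admissible (suc a) (suc b))) ⟨
  durfee a b +ₚ shift (suc b) (durfee (suc a) (suc b)) ∎
  where
  open ≈ₚ-Reasoning
  u : ℕ → FPS
  u n = shift (suc b) (durfeeTerm (suc a) (suc b) n)

durfee-recˡ : ∀ a b → durfee a b ≈ₚ durfee (suc a) b +ₚ shift (suc a) (durfee (suc (suc a)) (suc b))
durfee-recˡ a b = begin
  durfee a b
    ≈⟨ Σ∞-head (durfeeTerm a b) (durfeeTerm-admissible a b) ⟩
  t 0 +ₚ Σ∞ (durfeeTerm a b ∘ suc)
    ≈⟨ +ₚ-congˡ (t 0) (Σ∞-cong (durfeeTerm-recˡ a b)) ⟩
  t 0 +ₚ Σ∞ (λ n → t (suc n) +ₚ u n)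
    ≈⟨ +ₚ-congˡ (t 0) (Σ∞-+ₚ (t ∘ suc) u) ⟩
  t 0 +ₚ (Σ∞ (t ∘ suc) +ₚ Σ∞ u)
    ≈⟨ +ₚ-assoc (t 0) (Σ∞ (t ∘ suc)) (Σ∞ u) ⟨
  t 0 +ₚ Σ∞ (t ∘ suc) +ₚ Σ∞ u
    ≈⟨ +ₚ-cong (Σ∞-head t (durfeeTerm-admissible (suc a) b))
               (Σ∞-shift (suc a) (durfeeTerm (suc (suc a)) (suc b))
                         (durfeeTerm-admissible (suc (suc a)) (suc b))) ⟨
  durfee (suc a) b +ₚ shift (suc a) (durfee (suc (suc a)) (suc b)) ∎
  where
  open ≈ₚ-Reasoning
  t : ℕ → FPS
  t = durfeeTerm (suc a) b
  u : ℕ → FPS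
  u n = shift (suc a) (durfeeTerm (suc (suc a)) (suc b) n)

shift-coeff-cong : ∀ a {f g} c → (∀ d → a + d ≤ c → f d ≡ g d) → shift a f c ≡ shift a g c
shift-coeff-cong a {f} {g} c f≡g with shiftView a c
... | below c<a = trans (shift-below a f c<a) (sym (shift-below a g c<a))
... | beyond d  = trans (shift-at a f d) (trans (f≡g d ≤-refl) (sym (shift-at a g d)))

recurrence⇒stationary : ∀ (F : ℕ → FPS) →
  (∀ m → F m +ₚ shift (suc m) (F (suc m)) ≈ₚ F (suc m) +ₚ shift (suc m) (F (suc (suc m)))) →
  ∀ m → F m ≈ₚ F (suc m)
recurrence⇒stationary F rec m c = <-rec (λ c → ∀ m → F m c ≡ F (suc m) c) step c m
  where
  step : ∀ c → (∀ {d} → d < c → ∀ m → F m d ≡ F (suc m) d) → ∀ m → F m c ≡ F (suc m) c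
  step c ih m = ∙-cancelʳ (shift (suc m) (F (suc (suc m))) c) (F m c) (F (suc m) c)
    (trans (cong (F m c +ℤ_) (sym tails)) (rec m c))
    where
    tails : shift (suc m) (F (suc m)) c ≡ shift (suc m) (F (suc (suc m))) c
    tails = shift-coeff-cong (suc m) c (λ d m+d<c → ih (<-≤-trans (s≤s (m≤n+m d m)) m+d<c) (suc m))

stationary⇒constant : ∀ (F : ℕ → FPS) → (∀ m → F m ≈ₚ F (suc m)) → ∀ m n → F m ≈ₚ F n
stationary⇒constant F stationary m n = ≈ₚ-trans (≈F₀ m) (≈ₚ-sym (≈F₀ n))
  where
  ≈F₀ : ∀ m → F m ≈ₚ F 0
  ≈F₀ zero    = ≈ₚ-refl
  ≈F₀ (suc m) = ≈ₚ-trans (≈ₚ-sym (stationary m)) (≈F₀ m)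

durfee-below : ∀ a b {c} → c ≤ a → durfee a b c ≡ qPochInv b c
durfee-below a b {c} c≤a = begin
  durfee a b c
    ≡⟨ Σ∞-coeff (durfeeTerm a b) c ⟩
  (oneₚ *ₚ qPochInv b) c +ℤ ∑ c (λ n → durfeeTerm a b (suc n) c)
    ≡⟨ cong₂ _+ℤ_ (*ₚ-identityˡ (qPochInv b) c) (∑-zero c (λ n _ → shift-below _ _ (c<order n))) ⟩
  qPochInv b c +ℤ 0ℤ
    ≡⟨ ℤ.+-identityʳ _ ⟩
  qPochInv b c ∎
  where
  open ≡-Reasoning
  c<order : ∀ n → c < suc n * (suc n + a)
  c<order n = <-≤-trans (s≤s (≤-trans c≤a (m≤n+m a n))) (m≤n*m (suc n + a) (suc n))

durfee-diagonal : ∀ m → durfee m m ≈ₚ qPochInvInf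
durfee-diagonal m c = trans (constant m c c) (durfee-below c c ≤-refl)
  where
  constant : ∀ m n → durfee m m ≈ₚ durfee n n
  constant = stationary⇒constant (λ m → durfee m m) (recurrence⇒stationary (λ m → durfee m m)
    (λ m → ≈ₚ-trans (≈ₚ-sym (durfee-recʳ m m)) (durfee-recˡ m (suc m))))

tri-suc : ∀ n → tri (suc n) ≡ tri n + suc n
tri-suc n = begin
  suc n * suc (suc n) / 2        ≡⟨ /-congˡ (expand n) ⟩
  (n * suc n + suc n * 2) / 2    ≡⟨ +-distrib-/-∣ʳ (n * suc n) (divides (suc n) refl) ⟩
  tri n + suc n * 2 / 2          ≡⟨ cong (tri n +_) (m*n/n≡m (suc n) 2) ⟩
  tri n + suc n                  ∎
  where
  open ≡-Reasoning
  expand : ∀ n → suc n * suc (suc n) ≡ n * suc n + suc n * 2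
  expand = ℕ-Solver.solve-∀

qPochInvInf-split : ∀ j → qPochInvInf ≈ₚ durfee (2 + j) (1 + j) +ₚ shift (2 + j) (durfee (3 + j) (2 + j))
qPochInvInf-split j = ≈ₚ-trans (≈ₚ-sym (durfee-diagonal (2 + j))) (durfee-recʳ (2 + j) (1 + j))

remainder : ℕ → FPS
remainder j = shift (tri (suc j)) (durfee (2 + j) (1 + j))

shift-tri-qPochInvInf : ∀ j → shift (tri (suc j)) qPochInvInf ≈ₚ remainder j +ₚ remainder (suc j)
shift-tri-qPochInvInf j = begin
  shift T qPochInvInf
    ≈⟨ shift-cong T (qPochInvInf-split j) ⟩
  shift T (durfee (2 + j) (1 + j) +ₚ shift (2 + j) G)
    ≈⟨ shift-+ₚ T (durfee (2 + j) (1 + j)) (shift (2 + j) G) ⟩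
  remainder j +ₚ shift T (shift (2 + j) G)
    ≈⟨ +ₚ-congˡ (remainder j) (shift-shift T (2 + j) G) ⟩
  remainder j +ₚ shift (T + (2 + j)) G
    ≡⟨ cong (λ e → remainder j +ₚ shift e G) (sym (tri-suc (suc j))) ⟩
  remainder j +ₚ remainder (suc j) ∎
  where
  open ≈ₚ-Reasoning
  T = tri (suc j)
  G = durfee (3 + j) (2 + j)

qpow-*ₚ-*ₚ : ∀ e f g → qpow e *ₚ f *ₚ g ≈ₚ shift e (f *ₚ g)
qpow-*ₚ-*ₚ e f g = ≈ₚ-trans (*ₚ-congʳ g (qpow-*ₚ e f)) (shift-*ₚˡ e f g)

first-series : Σ∞ (λ n → qpow (suc n * suc n) *ₚ qPochInv n *ₚ qPochInv (suc n)) ≈ₚ remainder 0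
first-series = ≈ₚ-trans (Σ∞-cong term) (≈ₚ-sym (Σ∞-shift 1 (durfeeTerm 2 1) (durfeeTerm-admissible 2 1)))
  where
  square : ∀ n → suc n * suc n ≡ 1 + n * (n + 2)
  square = ℕ-Solver.solve-∀
  term : ∀ n → qpow (suc n * suc n) *ₚ qPochInv n *ₚ qPochInv (suc n) ≈ₚ shift 1 (durfeeTerm 2 1 n)
  term n = begin
    qpow (suc n * suc n) *ₚ qPochInv n *ₚ qPochInv (suc n)
      ≈⟨ qpow-*ₚ-*ₚ (suc n * suc n) (qPochInv n) (qPochInv (suc n)) ⟩
    shift (suc n * suc n) (qPochInv₂ n (suc n))
      ≡⟨ cong₂ (λ e y → shift e (qPochInv₂ n y)) (square n) (+-comm 1 n) ⟩
    shift (1 + n * (n + 2)) (qPochInv₂ n (n + 1))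
      ≈⟨ shift-shift 1 (n * (n + 2)) (qPochInv₂ n (n + 1)) ⟨
    shift 1 (durfeeTerm 2 1 n) ∎
    where open ≈ₚ-Reasoning

tail-series : ∀ k →
  Σ∞ (λ n → qpow (n * (n + k + 2)) *ₚ qPochInv n *ₚ qPochInv (n + k + 1)) ≈ₚ durfee (2 + k) (1 + k)
tail-series k = Σ∞-cong λ n →
  ≈ₚ-trans (qpow-*ₚ-*ₚ (n * (n + k + 2)) (qPochInv n) (qPochInv (n + k + 1)))
           (cong-app (cong₂ (λ e y → shift e (qPochInv₂ n y)) (exponent n k) (index n k)))
  where
  exponent : ∀ n k → n * (n + k + 2) ≡ n * (n + (2 + k))
  exponent = ℕ-Solver.solve-∀
  index : ∀ n k → n + k + 1 ≡ n + (1 + k)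
  index = ℕ-Solver.solve-∀

corollary4p5 : (k : ℕ) → 1 ≤ k →
    qPochInvInf *ₚ Σ< k (λ i → sgn i ·ₚ qpow (tri (suc i)))
      ≈ₚ
    Σ∞ (λ n → qpow (suc n * suc n) *ₚ qPochInv n *ₚ qPochInv (suc n))
      +ₚ (sgn (k ∸ 1) ·ₚ qpow (tri (suc k)))
         *ₚ Σ∞ (λ n → qpow (n * (n + k + 2)) *ₚ qPochInv n *ₚ qPochInv (n + k + 1))
corollary4p5 zero    ()
corollary4p5 (suc k) _ = begin
  qPochInvInf *ₚ Σ< (suc k) (λ i → sgn i ·ₚ qpow (tri (suc i)))
    ≈⟨ *ₚ-distribˡ-Σ< qPochInvInf (suc k) (λ i → sgn i ·ₚ qpow (tri (suc i))) ⟩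
  Σ< (suc k) (λ i → qPochInvInf *ₚ (sgn i ·ₚ qpow (tri (suc i))))
    ≈⟨ Σ<-cong (suc k) summand ⟩
  Σ< (suc k) (λ i → sgn i ·ₚ (remainder i +ₚ remainder (suc i)))
    ≈⟨ Σ<-alternating-telescope remainder k ⟩
  remainder 0 +ₚ sgn k ·ₚ remainder (suc k)
    ≈⟨ +ₚ-cong first-series scaled-tail ⟨
  _ ∎
  where
  open ≈ₚ-Reasoning
  summand : ∀ i → qPochInvInf *ₚ (sgn i ·ₚ qpow (tri (suc i))) ≈ₚ sgn i ·ₚ (remainder i +ₚ remainder (suc i))
  summand i = ≈ₚ-trans (*ₚ-scalarʳ (sgn i) qPochInvInf (qpow (tri (suc i))))
    (·ₚ-cong (sgn i) (≈ₚ-trans (*ₚ-qpow (tri (suc i)) qPochInvInf) (shift-tri-qPochInvInf i)))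
  T = tri (suc (suc k))
  G = Σ∞ (λ n → qpow (n * (n + suc k + 2)) *ₚ qPochInv n *ₚ qPochInv (n + suc k + 1))
  scaled-tail : (sgn k ·ₚ qpow T) *ₚ G ≈ₚ sgn k ·ₚ remainder (suc k)
  scaled-tail = ≈ₚ-trans (*ₚ-scalarˡ (sgn k) (qpow T) G)
    (·ₚ-cong (sgn k) (≈ₚ-trans (qpow-*ₚ T G) (shift-cong T (tail-series (suc k)))))
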